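{- For every integer $s\ge1$ there exists an integer $C_s\ge 1$ such that the following holds. Let $G/\Gamma$ be a filtered nilmanifold of degree $s$ and dimension $d$ with Mal'cev basis $\mathcal{X}=\{X_1,\ldots,X_d\}$, and suppose all Lie bracket structure constants $c_{ijk}$ of $G/\Gamma$ (with respect to $\mathcal{X}$) are integers divisible by $C_s$. Then $\psi_{\exp}(\Gamma)=\mathbb{Z}^d$.
   Context: A filtered nilmanifold $G/\Gamma$ of degree $s$ consists of: a connected, simply connected nilpotent Lie group $G$ of dimension $d$; a filtration $G=G_0=G_1\geqslant\cdots\geqslant G_s\geqslant G_{s+1}=\{\mathrm{id}_G\}$ of closed connected subgroups with $[G_i,G_j]\subseteq G_{i+j}$; a discrete cocompact subgroup $\Gamma$; and a Mal'cev basis $X_1,\ldots,X_d$ of $\log G$ with (1) $[X_i,X_j]=\sum_{\max(i,j)<k\le d}c_{ijk}X_k$ for rational numbers $c_{ijk}$ (the Lie bracket structure constants); (2) $\log G_i=\mathrm{span}\{X_j\colon d-\dim G_i<j\le d\}$; (3) $\Gamma=\{\exp(t_1X_1)\cdots\exp(t_dX_d)\colon t_i\in\mathbb{Z}\}$. Mal'cev coordinates of the first kind: $\psi_{\exp}(g)=(t_1,\ldots,t_d)$ where $g=\exp(t_1X_1+\cdots+t_dX_d)$. -}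

module Defs where

open import Data.Nat as ℕ using (ℕ; zero; suc; _∸_; _≤_; _<_; _!)
open import Data.Integer as ℤ using (ℤ; +_)
open import Data.Rational as ℚ using (ℚ; 0ℚ; 1ℚ; _/_)
open import Data.Fin using (Fin; toℕ; _≟_)
open import Data.Product using (_×_; _,_; proj₁; proj₂; Σ; ∃)
open import Data.List as List using (List; []; _∷_; _++_; map; concatMap; upTo; allFin; foldl; foldr; length)
open import Relation.Nullary using (yes; no)
open import Relation.Binary.PropositionalEquality using (_≡_)

-- Vectors in ℚ^d (first-kind Mal'cev coordinates; log G ⊇ ℚ-span of X)

Vec : ℕ → Set
Vec d = Fin d → ℚ

-- structure constants c i j k : [X_i , X_j] = Σ_k c i j k X_k  (0-indexed)
Struct : ℕ → Set
Struct d = Fin d → Fin d → Fin d → ℚ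

sumFin : (n : ℕ) → (Fin n → ℚ) → ℚ
sumFin zero f = 0ℚ
sumFin (suc n) f = f Data.Fin.zero ℚ.+ sumFin n (λ i → f (Data.Fin.suc i))

zeroV : ∀ {d} → Vec d
zeroV _ = 0ℚ

_+V_ : ∀ {d} → Vec d → Vec d → Vec d
(x +V y) i = x i ℚ.+ y i

_·V_ : ∀ {d} → ℚ → Vec d → Vec d
(q ·V x) i = q ℚ.* x i

negV : ∀ {d} → Vec d → Vec d
negV x i = ℚ.- x i

bracket : ∀ {d} → Struct d → Vec d → Vec d → Vec d
bracket {d} c x y k = sumFin d (λ i → sumFin d (λ j → x i ℚ.* (y j ℚ.* c i j k)))

basis : ∀ {d} → Fin d → Vec d
basis i j with i ≟ j
... | yes _ = 1ℚ
... | no  _ = 0ℚ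

embedℤ : ∀ {d} → (Fin d → ℤ) → Vec d
embedℤ z i = z i / 1

-- Baker–Campbell–Hausdorff product (Dynkin's formula), truncated at
-- total bracket length N (exact when the Lie algebra is nilpotent with
-- all brackets of length > N vanishing).

-- pairs (r , t) with 1 ≤ r + t ≤ b
pairs : ℕ → List (ℕ × ℕ)
pairs b = map (λ t → (0 , suc t)) (upTo b)
       ++ concatMap (λ r → map (λ t → (suc r , t)) (upTo (suc (b ∸ suc r)))) (upTo b)

size : ℕ × ℕ → ℕ
size (r , t) = r ℕ.+ t

-- all sequences of pairs of length ≤ fuel with total size ≤ b (incl. empty)
seqs : ℕ → ℕ → List (List (ℕ × ℕ))
seqs zero b = [] ∷ []
seqs (suc f) b = [] ∷ concatMap (λ p → map (p ∷_) (seqs f (b ∸ size p))) (pairs b)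

-- reciprocal of a natural number (only used on positive arguments)
recip : ℕ → ℚ
recip zero = 0ℚ
recip (suc k) = + 1 / suc k

replicateL : ∀ {A : Set} → ℕ → A → List A
replicateL zero a = []
replicateL (suc n) a = a ∷ replicateL n a

word : ∀ {A : Set} → A → A → List (ℕ × ℕ) → List A
word x y [] = []
word x y ((r , t) ∷ σ) = replicateL r x ++ (replicateL t y ++ word x y σ)

nest : ∀ {d} → Struct d → List (Vec d) → Vec d
nest c [] = zeroV
nest c (x ∷ []) = x
nest c (x ∷ y ∷ ys) = bracket c x (nest c (y ∷ ys))

totalSize : List (ℕ × ℕ) → ℕ
totalSize = foldr (λ p n → size p ℕ.+ n) 0

factProd : List (ℕ × ℕ) → ℕ
factProd = foldr (λ p n → (proj₁ p !) ℕ.* ((proj₂ p !) ℕ.* n)) 1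

sign : ℕ → ℚ
sign zero = 1ℚ
sign (suc n) = ℚ.- sign n

dynkinTerm : ∀ {d} → Struct d → Vec d → Vec d → List (ℕ × ℕ) → Vec d
dynkinTerm c x y [] = zeroV
dynkinTerm c x y σ@(_ ∷ τ) =
  (sign (length τ) ℚ.* recip (length σ ℕ.* (totalSize σ ℕ.* factProd σ)))
    ·V nest c (word x y σ)

-- group law of G in first-kind coordinates: log(exp x · exp y)
mul : ∀ {d} → ℕ → Struct d → Vec d → Vec d → Vec d
mul N c x y = foldr _+V_ zeroV (map (dynkinTerm c x y) (seqs N N))

-- second-kind product exp(t_1 X_1) ⋯ exp(t_d X_d), in first-kind coordinates
secondKind : ∀ {d} → ℕ → Struct d → (Fin d → ℤ) → Vec d
secondKind {d} N c t = foldl (mul N c) zeroV (map (λ i → (t i / 1) ·V basis i) (allFin d))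

_≈V_ : ∀ {d} → Vec d → Vec d → Set
x ≈V y = ∀ i → x i ≡ y i

record IsFilteredNilmanifold (s d : ℕ) (c : Struct d) (D : ℕ → ℕ) : Set where
  field
    antisym  : ∀ i j k → c i j k ≡ ℚ.- c j i k
    jacobi   : ∀ i j l →
      (bracket c (basis i) (bracket c (basis j) (basis l))
        +V (bracket c (basis j) (bracket c (basis l) (basis i))
        +V  bracket c (basis l) (bracket c (basis i) (basis j)))) ≈V zeroV
    triangular : ∀ i j k → (toℕ k ≤ toℕ i) → c i j k ≡ 0ℚ
    triangular' : ∀ i j k → (toℕ k ≤ toℕ j) → c i j k ≡ 0ℚ
    -- filtration: D i = dim G_i, log G_i = span{X_k : k ≥ d - D i} (0-indexed), (2)
    dim0     : D 0 ≡ d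
    dim1     : D 1 ≡ d
    dimMono  : ∀ i → D (suc i) ≤ D i
    dimTop   : D (suc s) ≡ 0
    -- [G_i , G_j] ⊆ G_{i+j}, at the Lie algebra level on basis vectors
    filtered : ∀ i j a b k → d ∸ D i ≤ toℕ a → d ∸ D j ≤ toℕ b →
               toℕ k < d ∸ D (i ℕ.+ j) → c a b k ≡ 0ℚ
    -- (3): Γ = {exp(t_1X_1)⋯exp(t_dX_d) : t ∈ ℤ^d} is a subgroup of G
    Γ-mul    : ∀ t u → ∃ λ v → mul s c (secondKind s c t) (secondKind s c u) ≈V secondKind s c v
    Γ-inv    : ∀ t → ∃ λ v → negV (secondKind s c t) ≈V secondKind s c v

AllDivisibleBy : ∀ {d} → ℕ → Struct d → Set
AllDivisibleBy C c = ∀ i j k → ∃ λ (m : ℤ) → c i j k ≡ (+ C / 1) ℚ.* (m / 1)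

PsiExpΓIsℤ^d : ∀ {d} → ℕ → Struct d → Set
PsiExpΓIsℤ^d {d} N c =
  (∀ t → ∃ λ (z : Fin d → ℤ) → secondKind N c t ≈V embedℤ z)
  × (∀ (z : Fin d → ℤ) → ∃ λ t → embedℤ z ≈V secondKind N c t)

{-# OPTIONS --safe #-}
-- Write the truncated BCH product as x ⋆ y = x + y + H(x, y), where H collects the Dynkin terms
-- of degree ≥ 2. Each of these is ±1/den times an iterated bracket of x's and y's, and a bracket
-- of integer vectors is a multiple of C when all structure constants are; so taking for C the
-- product of the Dynkin denominators, ⋆ preserves ℤ^d, and hence ψ_exp(Γ) ⊆ ℤ^d.
-- Since [X_i, X_j] only involves X_k with k > max(i, j), coordinate k of H(x, y) depends only on
-- the coordinates of x and y below k. Consequently coordinate k of exp(t₁X₁)⋯exp(t_dX_d) is t_k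
-- plus an integer depending only on t₁, …, t_{k-1}, and such a map ℤ^d → ℤ^d is onto: solve for
-- the t_k one after the other, i.e. iterate a strictly triangular map d times.
module Submission where

open import Defs
open import Data.Nat using (ℕ; _≤_)
open import Data.Product using (_×_; ∃)

open import Function using (_∘_)
open import Data.Nat as ℕ using (zero; suc; _<_; _∸_; _!; z≤n; s≤s; NonZero)
import Data.Nat.Properties as ℕP
open import Data.Nat.Divisibility using (_∣_; divides)
open import Data.Nat.ListAction using (product)
open import Data.Nat.ListAction.Properties using (∈⇒∣product; product≢0)
open import Data.Nat.Coprimality using (1-coprimeTo) renaming (sym to coprime-sym)
open import Data.Integer as ℤ using (ℤ; +_; -[1+_]; +[1+_])
import Data.Integer.Properties as ℤP
open import Data.Integer.Tactic.RingSolver using (solve-∀)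
open import Data.Rational as ℚ using (ℚ; mkℚ; 0ℚ; 1ℚ; _/_; ↥_)
import Data.Rational.Properties as ℚP
open import Data.Rational.Solver using (module +-*-Solver)
open import Data.Fin as Fin using (Fin; toℕ; _≟_)
import Data.Fin.Properties as FinP
open import Data.Product using (_,_; proj₁; proj₂)
open import Data.List
  using (List; []; _∷_; _++_; map; concatMap; applyUpTo; upTo; foldl; foldr; length; replicate; tabulate; allFin)
import Data.List.Properties as ListP
open import Data.List.Membership.Propositional.Properties using (∈-map⁺)
open import Data.List.Relation.Unary.All as All using (All; []; _∷_)
import Data.List.Relation.Unary.All.Properties as AllP
open import Data.List.Relation.Binary.Pointwise as Pointwise using (Pointwise; []; _∷_)
open import Relation.Nullary using (yes; no)
open import Relation.Binary.PropositionalEquality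
open ≡-Reasoning

open +-*-Solver using (solve; _:+_; _:*_; _:-_; _:=_; con)

fromℤ : ℤ → ℚ
fromℤ i = i / 1

fromℤ≡mkℚ : ∀ i → fromℤ i ≡ mkℚ i 0 (coprime-sym (1-coprimeTo _))
fromℤ≡mkℚ i = ℚP.↥p/↧p≡p (mkℚ i 0 (coprime-sym (1-coprimeTo _)))

fromℤ-+ : ∀ i j → fromℤ i ℚ.+ fromℤ j ≡ fromℤ (i ℤ.+ j)
fromℤ-+ i j rewrite fromℤ≡mkℚ i | fromℤ≡mkℚ j =
  cong₂ (λ m n → (m ℤ.+ n) / 1) (ℤP.*-identityʳ i) (ℤP.*-identityʳ j)

fromℤ-* : ∀ i j → fromℤ i ℚ.* fromℤ j ≡ fromℤ (i ℤ.* j)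
fromℤ-* i j rewrite fromℤ≡mkℚ i | fromℤ≡mkℚ j = refl

fromℤ-neg : ∀ i → ℚ.- fromℤ i ≡ fromℤ (ℤ.- i)
fromℤ-neg i rewrite fromℤ≡mkℚ i | fromℤ≡mkℚ (ℤ.- i) with i
... | + 0      = refl
... | +[1+ n ] = refl
... | -[1+ n ] = refl

fromℤ-minus : ∀ i j → fromℤ i ℚ.- fromℤ j ≡ fromℤ (i ℤ.- j)
fromℤ-minus i j = trans (cong (fromℤ i ℚ.+_) (fromℤ-neg j)) (fromℤ-+ i (ℤ.- j))

fromℤ-injective : ∀ {i j} → fromℤ i ≡ fromℤ j → i ≡ j
fromℤ-injective {i} {j} eq rewrite fromℤ≡mkℚ i | fromℤ≡mkℚ j = cong ↥_ eq

a-[b-c]≡c⇒b≡a : ∀ {a b c : ℤ} → a ℤ.- (b ℤ.- c) ≡ c → b ≡ a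
a-[b-c]≡c⇒b≡a {a} {b} {c} eq = begin
  b                                 ≡⟨ b≡[b-c]+c b c ⟩
  (b ℤ.- c) ℤ.+ c                   ≡⟨ cong (λ e → (b ℤ.- c) ℤ.+ e) eq ⟨
  (b ℤ.- c) ℤ.+ (a ℤ.- (b ℤ.- c))   ≡⟨ [b-c]+[a-[b-c]]≡a a b c ⟩
  a                                 ∎
  where
  b≡[b-c]+c : ∀ b c → b ≡ (b ℤ.- c) ℤ.+ c
  b≡[b-c]+c = solve-∀

  [b-c]+[a-[b-c]]≡a : ∀ a b c → (b ℤ.- c) ℤ.+ (a ℤ.- (b ℤ.- c)) ≡ a
  [b-c]+[a-[b-c]]≡a = solve-∀

IsInt : ℚ → Set
IsInt q = ∃ λ i → q ≡ fromℤ i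

isInt-0 : IsInt 0ℚ
isInt-0 = + 0 , refl

isInt-1 : IsInt 1ℚ
isInt-1 = + 1 , refl

isInt-+ : ∀ {p q} → IsInt p → IsInt q → IsInt (p ℚ.+ q)
isInt-+ (i , refl) (j , refl) = i ℤ.+ j , fromℤ-+ i j

isInt-* : ∀ {p q} → IsInt p → IsInt q → IsInt (p ℚ.* q)
isInt-* (i , refl) (j , refl) = i ℤ.* j , fromℤ-* i j

isInt-sign : ∀ n → IsInt (sign n)
isInt-sign zero    = isInt-1
isInt-sign (suc n) with isInt-sign n
... | i , eq = ℤ.- i , trans (cong ℚ.-_ eq) (fromℤ-neg i)

recip-*-fromℤ : ∀ n → recip (suc n) ℚ.* fromℤ (+ suc n) ≡ 1ℚ
recip-*-fromℤ n = trans (cong₂ ℚ._*_ recip≡1/ (fromℤ≡mkℚ (+ suc n))) (ℚP.*-inverseˡ (mkℚ (+ suc n) 0 (coprime-sym (1-coprimeTo _))))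
  where
  recip≡1/ : recip (suc n) ≡ ℚ.1/ mkℚ (+ suc n) 0 (coprime-sym (1-coprimeTo _))
  recip≡1/ = ℚP.normalize-coprime (1-coprimeTo _)

module MultiplesOf (C : ℕ) where

  IsMultiple : ℚ → Set
  IsMultiple q = ∃ λ i → q ≡ fromℤ (+ C) ℚ.* fromℤ i

  multiple-0 : IsMultiple 0ℚ
  multiple-0 = + 0 , sym (ℚP.*-zeroʳ (fromℤ (+ C)))

  multiple-+ : ∀ {p q} → IsMultiple p → IsMultiple q → IsMultiple (p ℚ.+ q)
  multiple-+ (i , refl) (j , refl) = i ℤ.+ j ,
    trans (sym (ℚP.*-distribˡ-+ (fromℤ (+ C)) (fromℤ i) (fromℤ j))) (cong (fromℤ (+ C) ℚ.*_) (fromℤ-+ i j))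

  isInt-*-multiple : ∀ {p q} → IsInt p → IsMultiple q → IsMultiple (p ℚ.* q)
  isInt-*-multiple (i , refl) (j , refl) = i ℤ.* j , (begin
    fromℤ i ℚ.* (fromℤ (+ C) ℚ.* fromℤ j)
      ≡⟨ solve 3 (λ a c b → a :* (c :* b) := c :* (a :* b)) refl (fromℤ i) (fromℤ (+ C)) (fromℤ j) ⟩
    fromℤ (+ C) ℚ.* (fromℤ i ℚ.* fromℤ j)
      ≡⟨ cong (fromℤ (+ C) ℚ.*_) (fromℤ-* i j) ⟩
    fromℤ (+ C) ℚ.* fromℤ (i ℤ.* j) ∎)

  multiple⇒isInt : ∀ {q} → IsMultiple q → IsInt q
  multiple⇒isInt (i , refl) = isInt-* (+ C , refl) (i , refl)

  sumFin-multiple : ∀ n {f : Fin n → ℚ} → (∀ i → IsMultiple (f i)) → IsMultiple (sumFin n f)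
  sumFin-multiple zero    _      = multiple-0
  sumFin-multiple (suc n) f-mult = multiple-+ (f-mult Fin.zero) (sumFin-multiple n (f-mult ∘ Fin.suc))

  -- Also true for n = 0, as recip 0 = 0.
  recip-*-multiple : ∀ {q} n → n ∣ C → IsMultiple q → IsInt (recip n ℚ.* q)
  recip-*-multiple zero _ (i , refl) = + 0 , ℚP.*-zeroˡ (fromℤ (+ C) ℚ.* fromℤ i)
  recip-*-multiple (suc n) (divides m C≡m*n) (i , refl) = + m ℤ.* i , (begin
    recip (suc n) ℚ.* (fromℤ (+ C) ℚ.* fromℤ i)
      ≡⟨ cong (λ c → recip (suc n) ℚ.* (c ℚ.* fromℤ i)) fromℤC≡ ⟩
    recip (suc n) ℚ.* ((fromℤ (+ m) ℚ.* fromℤ (+ suc n)) ℚ.* fromℤ i)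
      ≡⟨ solve 4 (λ r a b c → r :* ((a :* b) :* c) := (a :* c) :* (r :* b)) refl
           (recip (suc n)) (fromℤ (+ m)) (fromℤ (+ suc n)) (fromℤ i) ⟩
    (fromℤ (+ m) ℚ.* fromℤ i) ℚ.* (recip (suc n) ℚ.* fromℤ (+ suc n))
      ≡⟨ cong₂ ℚ._*_ (fromℤ-* (+ m) i) (recip-*-fromℤ n) ⟩
    fromℤ (+ m ℤ.* i) ℚ.* 1ℚ
      ≡⟨ ℚP.*-identityʳ _ ⟩
    fromℤ (+ m ℤ.* i) ∎)
    where
    fromℤC≡ : fromℤ (+ C) ≡ fromℤ (+ m) ℚ.* fromℤ (+ suc n)
    fromℤC≡ = trans (cong (fromℤ ∘ +_) C≡m*n)
                    (trans (cong fromℤ (ℤP.pos-* m (suc n))) (sym (fromℤ-* (+ m) (+ suc n))))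

  IsMultipleV : ∀ {d} → Vec d → Set
  IsMultipleV x = ∀ k → IsMultiple (x k)

IsIntV : ∀ {d} → Vec d → Set
IsIntV x = ∀ k → IsInt (x k)

AgreeBelow : ∀ {A : Set} {d} → ℕ → (Fin d → A) → (Fin d → A) → Set
AgreeBelow K u v = ∀ j → toℕ j < K → u j ≡ v j

agreeBelow-weaken : ∀ {A : Set} {d K} {u v : Fin d → A} → AgreeBelow (suc K) u v → AgreeBelow K u v
agreeBelow-weaken u≈v j j<K = u≈v j (ℕP.m<n⇒m<1+n j<K)

sumV : ∀ {d} → List (Vec d) → Vec d
sumV = foldr _+V_ zeroV

sumV-++ : ∀ {d} (us vs : List (Vec d)) k → sumV (us ++ vs) k ≡ sumV us k ℚ.+ sumV vs k
sumV-++ []       vs k = sym (ℚP.+-identityˡ _)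
sumV-++ (u ∷ us) vs k = trans (cong (u k ℚ.+_) (sumV-++ us vs k)) (sym (ℚP.+-assoc (u k) _ _))

sumV-map-++ : ∀ {A : Set} {d} (f : A → Vec d) xs ys k →
  sumV (map f (xs ++ ys)) k ≡ sumV (map f xs) k ℚ.+ sumV (map f ys) k
sumV-map-++ f xs ys k = trans (cong (λ vs → sumV vs k) (ListP.map-++ f xs ys)) (sumV-++ (map f xs) _ k)

sumV-int : ∀ {d} {vs : List (Vec d)} → All IsIntV vs → IsIntV (sumV vs)
sumV-int = ListP.foldr-preservesᵇ (λ x-int y-int k → isInt-+ (x-int k) (y-int k)) (λ _ → isInt-0)

sumV-map-agree : ∀ {A : Set} {d K} (f g : A → Vec d) xs →
  All (λ a → AgreeBelow K (f a) (g a)) xs → AgreeBelow K (sumV (map f xs)) (sumV (map g xs))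
sumV-map-agree f g []       []             j j<K = refl
sumV-map-agree f g (x ∷ xs) (fx≈gx ∷ f≈g) j j<K =
  cong₂ ℚ._+_ (fx≈gx j j<K) (sumV-map-agree f g xs f≈g j j<K)

sumV-tabulate : ∀ {d} n (g : Fin n → Vec d) k → sumV (tabulate g) k ≡ sumFin n (λ i → g i k)
sumV-tabulate zero    g k = refl
sumV-tabulate (suc n) g k = cong (g Fin.zero k ℚ.+_) (sumV-tabulate n (g ∘ Fin.suc) k)

sumFin-cong : ∀ n {f g : Fin n → ℚ} → (∀ i → f i ≡ g i) → sumFin n f ≡ sumFin n g
sumFin-cong zero    f≡g = refl
sumFin-cong (suc n) f≡g = cong₂ ℚ._+_ (f≡g Fin.zero) (sumFin-cong n (f≡g ∘ Fin.suc))

sumFin-zero : ∀ n {f : Fin n → ℚ} → (∀ i → f i ≡ 0ℚ) → sumFin n f ≡ 0ℚ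
sumFin-zero zero    f≡0 = refl
sumFin-zero (suc n) f≡0 = trans (cong₂ ℚ._+_ (f≡0 Fin.zero) (sumFin-zero n (f≡0 ∘ Fin.suc))) (ℚP.+-identityˡ 0ℚ)

basis-suc : ∀ {n} (i k : Fin n) → basis (Fin.suc i) (Fin.suc k) ≡ basis i k
basis-suc i k with i ≟ k
... | yes _ = refl
... | no  _ = refl

sumFin-basis : ∀ n (a : Fin n → ℚ) k → sumFin n (λ i → a i ℚ.* basis i k) ≡ a k
sumFin-basis (suc n) a Fin.zero = begin
  a Fin.zero ℚ.* 1ℚ ℚ.+ sumFin n (λ i → a (Fin.suc i) ℚ.* 0ℚ)
    ≡⟨ cong₂ ℚ._+_ (ℚP.*-identityʳ (a Fin.zero)) (sumFin-zero n (λ i → ℚP.*-zeroʳ (a (Fin.suc i)))) ⟩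
  a Fin.zero ℚ.+ 0ℚ
    ≡⟨ ℚP.+-identityʳ (a Fin.zero) ⟩
  a Fin.zero ∎
sumFin-basis (suc n) a (Fin.suc k) = begin
  a Fin.zero ℚ.* 0ℚ ℚ.+ sumFin n (λ i → a (Fin.suc i) ℚ.* basis (Fin.suc i) (Fin.suc k))
    ≡⟨ cong₂ ℚ._+_ (ℚP.*-zeroʳ (a Fin.zero)) (sumFin-cong n (λ i → cong (a (Fin.suc i) ℚ.*_) (basis-suc i k))) ⟩
  0ℚ ℚ.+ sumFin n (λ i → a (Fin.suc i) ℚ.* basis i k)
    ≡⟨ trans (ℚP.+-identityˡ _) (sumFin-basis n (a ∘ Fin.suc) k) ⟩
  a (Fin.suc k) ∎

scaledBasis : ∀ {d} → (Fin d → ℤ) → Fin d → Vec d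
scaledBasis t i = fromℤ (t i) ·V basis i

sumV-scaledBasis : ∀ {d} (t : Fin d → ℤ) k → sumV (map (scaledBasis t) (allFin d)) k ≡ fromℤ (t k)
sumV-scaledBasis {d} t k = begin
  sumV (map (scaledBasis t) (allFin d)) k ≡⟨ cong (λ vs → sumV vs k) (ListP.map-tabulate (λ i → i) (scaledBasis t)) ⟩
  sumV (tabulate (scaledBasis t)) k       ≡⟨ sumV-tabulate d (scaledBasis t) k ⟩
  sumFin d (λ i → scaledBasis t i k)      ≡⟨ sumFin-basis d (fromℤ ∘ t) k ⟩
  fromℤ (t k)                             ∎

scaledBasis-int : ∀ {d} (t : Fin d → ℤ) i → IsIntV (scaledBasis t i)
scaledBasis-int t i k with i ≟ k
... | yes _ = isInt-* (t i , refl) isInt-1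
... | no  _ = isInt-* (t i , refl) isInt-0

scaledBasis-agree : ∀ {d K} {t t' : Fin d → ℤ} → AgreeBelow K t t' → ∀ i → AgreeBelow K (scaledBasis t i) (scaledBasis t' i)
scaledBasis-agree {t = t} {t'} t≈t' i j j<K with i ≟ j
... | yes refl = cong (λ n → fromℤ n ℚ.* 1ℚ) (t≈t' i j<K)
... | no  _    = trans (ℚP.*-zeroʳ (fromℤ (t i))) (sym (ℚP.*-zeroʳ (fromℤ (t' i))))

-- Index sequences of Dynkin's formula

Higher : List (ℕ × ℕ) → Set
Higher σ = 2 ≤ totalSize σ

X¹ Y¹ : List (ℕ × ℕ)
X¹ = (1 , 0) ∷ []
Y¹ = (0 , 1) ∷ []

nonemptySeqs : ℕ → ℕ → List (List (ℕ × ℕ))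
nonemptySeqs zero    b = []
nonemptySeqs (suc f) b = concatMap (λ p → map (p ∷_) (seqs f (b ∸ size p))) (pairs b)

seqs≡[]∷nonemptySeqs : ∀ f b → seqs f b ≡ [] ∷ nonemptySeqs f b
seqs≡[]∷nonemptySeqs zero    b = refl
seqs≡[]∷nonemptySeqs (suc f) b = refl

extensions-bound : ∀ {n} (S : ℕ × ℕ → List (List (ℕ × ℕ))) ps → All (λ p → n ≤ size p) ps →
  All (λ σ → n ≤ totalSize σ) (concatMap (λ p → map (p ∷_) (S p)) ps)
extensions-bound S ps n≤ps = AllP.concat⁺ (AllP.map⁺ (All.map
  (λ {p} n≤p → AllP.map⁺ (All.universal (λ τ → ℕP.≤-trans n≤p (ℕP.m≤m+n (size p) (totalSize τ))) (S p)))
  n≤ps))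

pairs-positive : ∀ b → All (λ p → 1 ≤ size p) (pairs b)
pairs-positive b = AllP.++⁺
  (AllP.map⁺ (All.universal (λ _ → s≤s z≤n) (upTo b)))
  (AllP.concat⁺ (AllP.map⁺ (All.universal (λ r → AllP.map⁺ (All.universal (λ _ → s≤s z≤n) _)) (upTo b))))

nonemptySeqs-positive : ∀ f b → All (λ σ → 1 ≤ totalSize σ) (nonemptySeqs f b)
nonemptySeqs-positive zero    b = []
nonemptySeqs-positive (suc f) b = extensions-bound _ (pairs b) (pairs-positive b)

record LinearSplit (L : List (List (ℕ × ℕ))) : Set where
  field
    before after : List (List (ℕ × ℕ))
    split        : L ≡ [] ∷ Y¹ ∷ before ++ X¹ ∷ after
    all-higher   : All Higher (before ++ after)

  higher : List (List (ℕ × ℕ))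
  higher = before ++ after

-- pairs (suc b) is definitionally (0 , 1) ∷ P₀ ++ (1 , 0) ∷ P₁, and all pairs in P₀ and P₁ have size ≥ 2.
seqs-linearSplit : ∀ f b → LinearSplit (seqs (suc f) (suc b))
seqs-linearSplit f b = record
  { before     = A
  ; after      = B
  ; split      = cong ([] ∷_) split
  ; all-higher = AllP.++⁺ A-higher B-higher
  }
  where
  tails extensions : ℕ × ℕ → List (List (ℕ × ℕ))
  tails p      = seqs f (suc b ∸ size p)
  extensions p = map (p ∷_) (tails p)

  P₀ P₁ : List (ℕ × ℕ)
  P₀ = map (λ t → (0 , suc t)) (applyUpTo suc b)
  P₁ = map (λ t → (1 , t)) (applyUpTo suc b)
    ++ concatMap (λ r → map (λ t → (suc r , t)) (upTo (suc (suc b ∸ suc r)))) (applyUpTo suc b)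

  P₀-higher : All (λ p → 2 ≤ size p) P₀
  P₀-higher = AllP.map⁺ (AllP.applyUpTo⁺₂ suc b (λ _ → s≤s (s≤s z≤n)))

  P₁-higher : All (λ p → 2 ≤ size p) P₁
  P₁-higher = AllP.++⁺
    (AllP.map⁺ (AllP.applyUpTo⁺₂ suc b (λ _ → s≤s (s≤s z≤n))))
    (AllP.concat⁺ (AllP.map⁺ (AllP.applyUpTo⁺₂ suc b
      (λ _ → AllP.map⁺ (All.universal (λ _ → s≤s (s≤s z≤n)) _)))))

  cons-higher : ∀ p → 1 ≤ size p → All Higher (map (p ∷_) (nonemptySeqs f b))
  cons-higher p 1≤p = AllP.map⁺ (All.map (ℕP.+-mono-≤ 1≤p) (nonemptySeqs-positive f b))

  A B : List (List (ℕ × ℕ))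
  A = map ((0 , 1) ∷_) (nonemptySeqs f b) ++ concatMap extensions P₀
  B = map ((1 , 0) ∷_) (nonemptySeqs f b) ++ concatMap extensions P₁

  A-higher : All Higher A
  A-higher = AllP.++⁺ (cons-higher (0 , 1) (s≤s z≤n)) (extensions-bound tails P₀ P₀-higher)

  B-higher : All Higher B
  B-higher = AllP.++⁺ (cons-higher (1 , 0) (s≤s z≤n)) (extensions-bound tails P₁ P₁-higher)

  split : concatMap extensions (pairs (suc b)) ≡ Y¹ ∷ A ++ X¹ ∷ B
  split = begin
    concatMap extensions (pairs (suc b))
      ≡⟨⟩
    extensions (0 , 1) ++ concatMap extensions (P₀ ++ (1 , 0) ∷ P₁)
      ≡⟨ cong₂ _++_ (cong (map ((0 , 1) ∷_)) (seqs≡[]∷nonemptySeqs f b))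
                    (ListP.concatMap-++ extensions P₀ ((1 , 0) ∷ P₁)) ⟩
    Y¹ ∷ map ((0 , 1) ∷_) (nonemptySeqs f b) ++ concatMap extensions P₀ ++ extensions (1 , 0) ++ concatMap extensions P₁
      ≡⟨ cong (λ L → Y¹ ∷ map ((0 , 1) ∷_) (nonemptySeqs f b) ++ concatMap extensions P₀ ++ L ++ concatMap extensions P₁)
              (cong (map ((1 , 0) ∷_)) (seqs≡[]∷nonemptySeqs f b)) ⟩
    Y¹ ∷ map ((0 , 1) ∷_) (nonemptySeqs f b) ++ concatMap extensions P₀ ++ X¹ ∷ B
      ≡⟨ cong (Y¹ ∷_) (sym (ListP.++-assoc (map ((0 , 1) ∷_) (nonemptySeqs f b)) _ _)) ⟩
    Y¹ ∷ A ++ X¹ ∷ B ∎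

den : List (ℕ × ℕ) → ℕ
den σ = length σ ℕ.* (totalSize σ ℕ.* factProd σ)

factProd-nonZero : ∀ σ → NonZero (factProd σ)
factProd-nonZero []            = _
factProd-nonZero ((r , t) ∷ σ) = ℕP.m*n≢0 (r !) _
  {{r ℕP.!≢0}} {{ℕP.m*n≢0 (t !) (factProd σ) {{t ℕP.!≢0}} {{factProd-nonZero σ}}}}

den-nonZero : ∀ σ → Higher σ → NonZero (den σ)
den-nonZero σ@(_ ∷ _) σ-higher = ℕP.m*n≢0 (length σ) _
  {{_}} {{ℕP.m*n≢0 (totalSize σ) (factProd σ) {{ℕ.>-nonZero (ℕP.≤-trans (s≤s z≤n) σ-higher)}} {{factProd-nonZero σ}}}}

higherSeqs : ℕ → List (List (ℕ × ℕ))
higherSeqs s-1 = LinearSplit.higher (seqs-linearSplit s-1 s-1)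

dynkinConstant : ℕ → ℕ
dynkinConstant s-1 = product (map den (higherSeqs s-1))

dynkinConstant-positive : ∀ s-1 → 1 ≤ dynkinConstant s-1
dynkinConstant-positive s-1 = ℕ.>-nonZero⁻¹ _ {{product≢0 (AllP.map⁺ (All.map (λ {σ} → den-nonZero σ) all-higher))}}
  where open LinearSplit (seqs-linearSplit s-1 s-1)

den∣dynkinConstant : ∀ s-1 → All (λ σ → den σ ∣ dynkinConstant s-1) (higherSeqs s-1)
den∣dynkinConstant s-1 = All.tabulate λ σ∈ → ∈⇒∣product (∈-map⁺ den σ∈)

replicateL≡replicate : ∀ {A : Set} n (a : A) → replicateL n a ≡ replicate n a
replicateL≡replicate zero    a = refl
replicateL≡replicate (suc n) a = cong (a ∷_) (replicateL≡replicate n a)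

length-word : ∀ {A : Set} (x y : A) σ → length (word x y σ) ≡ totalSize σ
length-word x y []            = refl
length-word x y ((r , t) ∷ σ) = begin
  length (replicateL r x ++ replicateL t y ++ word x y σ)
    ≡⟨ ListP.length-++ (replicateL r x) ⟩
  length (replicateL r x) ℕ.+ length (replicateL t y ++ word x y σ)
    ≡⟨ cong (length (replicateL r x) ℕ.+_) (ListP.length-++ (replicateL t y)) ⟩
  length (replicateL r x) ℕ.+ (length (replicateL t y) ℕ.+ length (word x y σ))
    ≡⟨ cong₂ ℕ._+_ (length-replicateL r x) (cong₂ ℕ._+_ (length-replicateL t y) (length-word x y σ)) ⟩
  r ℕ.+ (t ℕ.+ totalSize σ)
    ≡⟨ ℕP.+-assoc r t (totalSize σ) ⟨
  r ℕ.+ t ℕ.+ totalSize σ ∎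
  where
  length-replicateL : ∀ {A : Set} n (a : A) → length (replicateL n a) ≡ n
  length-replicateL n a = trans (cong length (replicateL≡replicate n a)) (ListP.length-replicate n)

higher⇒long-word : ∀ {A : Set} (x y : A) σ → Higher σ → 2 ≤ length (word x y σ)
higher⇒long-word x y σ = subst (2 ≤_) (sym (length-word x y σ))

all-word : ∀ {A : Set} {P : A → Set} {x y} σ → P x → P y → All P (word x y σ)
all-word []            px py = []
all-word {P = P} ((r , t) ∷ σ) px py =
  AllP.++⁺ (all-replicateL r px) (AllP.++⁺ (all-replicateL t py) (all-word σ px py))
  where
  all-replicateL : ∀ {a} n → P a → All P (replicateL n a)
  all-replicateL {a} n pa = subst (All P) (sym (replicateL≡replicate n a)) (AllP.replicate⁺ n pa)

pointwise-word : ∀ {A : Set} {R : A → A → Set} {x x' y y'} σ → R x x' → R y y' → Pointwise R (word x y σ) (word x' y' σ)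
pointwise-word []            rx ry = []
pointwise-word {R = R} ((r , t) ∷ σ) rx ry =
  Pointwise.++⁺ (pointwise-replicateL r rx) (Pointwise.++⁺ (pointwise-replicateL t ry) (pointwise-word σ rx ry))
  where
  pointwise-replicateL : ∀ {a a'} n → R a a' → Pointwise R (replicateL n a) (replicateL n a')
  pointwise-replicateL {a} {a'} n raa' =
    subst₂ (Pointwise R) (sym (replicateL≡replicate n a)) (sym (replicateL≡replicate n a')) (Pointwise.replicate⁺ raa' n)

module IntegralBrackets {d} (c : Struct d) (C : ℕ) (c-multiple : AllDivisibleBy C c) where
  open MultiplesOf C

  bracket-multiple : ∀ {x y} → IsIntV x → IsIntV y → IsMultipleV (bracket c x y)
  bracket-multiple x-int y-int k = sumFin-multiple d λ i → sumFin-multiple d λ j →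
    isInt-*-multiple (x-int i) (isInt-*-multiple (y-int j) (c-multiple i j k))

  nest-int : ∀ {ws} → All IsIntV ws → IsIntV (nest c ws)
  nest-int []                          k = isInt-0
  nest-int (w-int ∷ [])                  = w-int
  nest-int (w-int ∷ ws-int@(_ ∷ _))    k = multiple⇒isInt (bracket-multiple w-int (nest-int ws-int) k)

  nest-multiple : ∀ {ws} → All IsIntV ws → 2 ≤ length ws → IsMultipleV (nest c ws)
  nest-multiple (w-int ∷ ws-int@(_ ∷ _)) _ = bracket-multiple w-int (nest-int ws-int)
  nest-multiple (_ ∷ []) (s≤s ())

  dynkinTerm-int : ∀ {x y} σ → Higher σ → den σ ∣ C → IsIntV x → IsIntV y → IsIntV (dynkinTerm c x y σ)
  dynkinTerm-int {x} {y} σ@(_ ∷ τ) σ-higher den∣C x-int y-int k =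
    subst IsInt (sym (ℚP.*-assoc (sign (length τ)) (recip (den σ)) _))
      (isInt-* (isInt-sign (length τ))
        (recip-*-multiple (den σ) den∣C (nest-multiple (all-word σ x-int y-int) (higher⇒long-word x y σ σ-higher) k)))

module TriangularBrackets {d} (c : Struct d)
  (c-vanishes₁ : ∀ i j k → toℕ k ≤ toℕ i → c i j k ≡ 0ℚ)
  (c-vanishes₂ : ∀ i j k → toℕ k ≤ toℕ j → c i j k ≡ 0ℚ) where

  bracket-agree : ∀ {K u u' v v'} → AgreeBelow K u u' → AgreeBelow K v v' →
    AgreeBelow (suc K) (bracket c u v) (bracket c u' v')
  bracket-agree {K} {u} {u'} {v} {v'} u≈u' v≈v' k (s≤s k≤K) =
    sumFin-cong d λ i → sumFin-cong d λ j → summand i j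
    where
    vanishing : ∀ {e} a b a' b' → e ≡ 0ℚ → a ℚ.* (b ℚ.* e) ≡ a' ℚ.* (b' ℚ.* e)
    vanishing a b a' b' refl =
      solve 4 (λ a b a' b' → a :* (b :* con 0ℚ) := a' :* (b' :* con 0ℚ)) refl a b a' b'

    summand : ∀ i j → u i ℚ.* (v j ℚ.* c i j k) ≡ u' i ℚ.* (v' j ℚ.* c i j k)
    summand i j with toℕ i ℕ.<? toℕ k | toℕ j ℕ.<? toℕ k
    ... | yes i<k | yes j<k = cong₂ (λ a b → a ℚ.* (b ℚ.* c i j k))
                                (u≈u' i (ℕP.<-≤-trans i<k k≤K)) (v≈v' j (ℕP.<-≤-trans j<k k≤K))
    ... | no i≮k  | _       = vanishing (u i) (v j) (u' i) (v' j) (c-vanishes₁ i j k (ℕP.≮⇒≥ i≮k))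
    ... | yes _   | no j≮k  = vanishing (u i) (v j) (u' i) (v' j) (c-vanishes₂ i j k (ℕP.≮⇒≥ j≮k))

  nest-agree : ∀ {K ws ws'} → Pointwise (AgreeBelow K) ws ws' → AgreeBelow K (nest c ws) (nest c ws')
  nest-agree []                        _ _ = refl
  nest-agree (w≈w' ∷ [])                   = w≈w'
  nest-agree (w≈w' ∷ ws≈ws'@(_ ∷ _))       = agreeBelow-weaken (bracket-agree w≈w' (nest-agree ws≈ws'))

  nest-agree-long : ∀ {K ws ws'} → Pointwise (AgreeBelow K) ws ws' → 2 ≤ length ws →
    AgreeBelow (suc K) (nest c ws) (nest c ws')
  nest-agree-long (w≈w' ∷ ws≈ws'@(_ ∷ _)) _ = bracket-agree w≈w' (nest-agree ws≈ws')
  nest-agree-long (_ ∷ []) (s≤s ())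

  dynkinTerm-agree : ∀ {K x x' y y'} σ → Higher σ → AgreeBelow K x x' → AgreeBelow K y y' →
    AgreeBelow (suc K) (dynkinTerm c x y σ) (dynkinTerm c x' y' σ)
  dynkinTerm-agree {x = x} {y = y} σ@(_ ∷ τ) σ-higher x≈x' y≈y' k k<K =
    cong (sign (length τ) ℚ.* recip (den σ) ℚ.*_)
      (nest-agree-long (pointwise-word σ x≈x' y≈y') (higher⇒long-word x y σ σ-higher) k k<K)

-- The truncated Baker–Campbell–Hausdorff product

module BCH (s-1 : ℕ) {d} (c : Struct d) where

  open LinearSplit (seqs-linearSplit s-1 s-1)

  infixl 6 _⋆_
  _⋆_ : Vec d → Vec d → Vec d
  _⋆_ = mul (suc s-1) c

  higherPart : Vec d → Vec d → Vec d
  higherPart x y = sumV (map (dynkinTerm c x y) higher)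

  ⋆≡+higherPart : ∀ x y k → (x ⋆ y) k ≡ (x k ℚ.+ y k) ℚ.+ higherPart x y k
  -- term X¹ and term Y¹ compute to 1ℚ ℚ.* x and 1ℚ ℚ.* y.
  ⋆≡+higherPart x y k = begin
    sumV (map term (seqs (suc s-1) (suc s-1))) k
      ≡⟨ cong (λ L → sumV (map term L) k) split ⟩
    0ℚ ℚ.+ (term Y¹ k ℚ.+ sumV (map term (before ++ X¹ ∷ after)) k)
      ≡⟨ cong₂ (λ u v → 0ℚ ℚ.+ (u ℚ.+ v)) (ℚP.*-identityˡ (y k)) (sumV-map-++ term before (X¹ ∷ after) k) ⟩
    0ℚ ℚ.+ (y k ℚ.+ (Σ before ℚ.+ (term X¹ k ℚ.+ Σ after)))
      ≡⟨ cong (λ u → 0ℚ ℚ.+ (y k ℚ.+ (Σ before ℚ.+ (u ℚ.+ Σ after)))) (ℚP.*-identityˡ (x k)) ⟩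
    0ℚ ℚ.+ (y k ℚ.+ (Σ before ℚ.+ (x k ℚ.+ Σ after)))
      ≡⟨ solve 4 (λ x y a b → con 0ℚ :+ (y :+ (a :+ (x :+ b))) := (x :+ y) :+ (a :+ b)) refl
           (x k) (y k) (Σ before) (Σ after) ⟩
    (x k ℚ.+ y k) ℚ.+ (Σ before ℚ.+ Σ after)
      ≡⟨ cong ((x k ℚ.+ y k) ℚ.+_) (sumV-map-++ term before after k) ⟨
    (x k ℚ.+ y k) ℚ.+ higherPart x y k ∎
    where
    term : List (ℕ × ℕ) → Vec d
    term = dynkinTerm c x y

    Σ : List (List (ℕ × ℕ)) → ℚ
    Σ L = sumV (map term L) k

  ⋆-excess≡higherPart : ∀ x y k → (x ⋆ y) k ℚ.- (x k ℚ.+ y k) ≡ higherPart x y k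
  ⋆-excess≡higherPart x y k = trans (cong (ℚ._- (x k ℚ.+ y k)) (⋆≡+higherPart x y k))
    (solve 2 (λ p h → (p :+ h) :- p := h) refl (x k ℚ.+ y k) (higherPart x y k))

  module Integral (C : ℕ) (c-multiple : AllDivisibleBy C c) (den∣C : All (λ σ → den σ ∣ C) higher) where
    open IntegralBrackets c C c-multiple

    ⋆-int : ∀ {x y} → IsIntV x → IsIntV y → IsIntV (x ⋆ y)
    ⋆-int {x} {y} x-int y-int k =
      subst IsInt (sym (⋆≡+higherPart x y k)) (isInt-+ (isInt-+ (x-int k) (y-int k)) (higherPart-int k))
      where
      higherPart-int : IsIntV (higherPart x y)
      higherPart-int = sumV-int (AllP.map⁺
        (All.zipWith (λ {σ} (σ-higher , den∣C) → dynkinTerm-int σ σ-higher den∣C x-int y-int) (all-higher , den∣C)))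

    secondKind-int : ∀ t → IsIntV (secondKind (suc s-1) c t)
    secondKind-int t = foldl-int (allFin d) (λ _ → isInt-0)
      where
      foldl-int : ∀ is {a} → IsIntV a → IsIntV (foldl _⋆_ a (map (scaledBasis t) is))
      foldl-int []       a-int = a-int
      foldl-int (i ∷ is) a-int = foldl-int is (⋆-int a-int (scaledBasis-int t i))

  module Triangular
    (c-vanishes₁ : ∀ i j k → toℕ k ≤ toℕ i → c i j k ≡ 0ℚ)
    (c-vanishes₂ : ∀ i j k → toℕ k ≤ toℕ j → c i j k ≡ 0ℚ) where
    open TriangularBrackets c c-vanishes₁ c-vanishes₂

    higherPart-agree : ∀ {K x x' y y'} → AgreeBelow K x x' → AgreeBelow K y y' →
      AgreeBelow (suc K) (higherPart x y) (higherPart x' y')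
    higherPart-agree {x = x} {x'} {y} {y'} x≈x' y≈y' = sumV-map-agree (dynkinTerm c x y) (dynkinTerm c x' y') higher
      (All.map (λ {σ} σ-higher → dynkinTerm-agree σ σ-higher x≈x' y≈y') all-higher)

    ⋆-agree : ∀ {K x x' y y'} → AgreeBelow K x x' → AgreeBelow K y y' → AgreeBelow K (x ⋆ y) (x' ⋆ y')
    ⋆-agree {x = x} {x'} {y} {y'} x≈x' y≈y' k k<K = begin
      (x ⋆ y) k                              ≡⟨ ⋆≡+higherPart x y k ⟩
      (x k ℚ.+ y k) ℚ.+ higherPart x y k     ≡⟨ cong₂ ℚ._+_ (cong₂ ℚ._+_ (x≈x' k k<K) (y≈y' k k<K))
                                                  (higherPart-agree x≈x' y≈y' k (ℕP.m<n⇒m<1+n k<K)) ⟩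
      (x' k ℚ.+ y' k) ℚ.+ higherPart x' y' k ≡⟨ ⋆≡+higherPart x' y' k ⟨
      (x' ⋆ y') k                            ∎

    ⋆-excess-agree : ∀ {x x' y y'} k → AgreeBelow (toℕ k) x x' → AgreeBelow (toℕ k) y y' →
      (x ⋆ y) k ℚ.- (x k ℚ.+ y k) ≡ (x' ⋆ y') k ℚ.- (x' k ℚ.+ y' k)
    ⋆-excess-agree {x} {x'} {y} {y'} k x≈x' y≈y' = begin
      (x ⋆ y) k ℚ.- (x k ℚ.+ y k)     ≡⟨ ⋆-excess≡higherPart x y k ⟩
      higherPart x y k                ≡⟨ higherPart-agree x≈x' y≈y' k (ℕP.n<1+n (toℕ k)) ⟩
      higherPart x' y' k              ≡⟨ ⋆-excess≡higherPart x' y' k ⟨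
      (x' ⋆ y') k ℚ.- (x' k ℚ.+ y' k) ∎

    foldl-⋆-excess-agree : ∀ {I : Set} (f g : I → Vec d) is {a a'} k →
      All (λ i → AgreeBelow (toℕ k) (f i) (g i)) is → AgreeBelow (toℕ k) a a' →
      foldl _⋆_ a (map f is) k ℚ.- (a k ℚ.+ sumV (map f is) k)
        ≡ foldl _⋆_ a' (map g is) k ℚ.- (a' k ℚ.+ sumV (map g is) k)
    foldl-⋆-excess-agree f g [] {a} {a'} k [] a≈a' =
      trans (no-excess (a k)) (sym (no-excess (a' k)))
      where
      no-excess : ∀ p → p ℚ.- (p ℚ.+ 0ℚ) ≡ 0ℚ
      no-excess = solve 1 (λ p → p :- (p :+ con 0ℚ) := con 0ℚ) refl
    foldl-⋆-excess-agree {I} f g (i ∷ is) {a} {a'} k (fi≈gi ∷ f≈g) a≈a' = begin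
      fold a f ℚ.- (a k ℚ.+ (f i k ℚ.+ Σ f))
        ≡⟨ regroup (fold a f) ((a ⋆ f i) k) (a k) (f i k) (Σ f) ⟩
      (fold a f ℚ.- ((a ⋆ f i) k ℚ.+ Σ f)) ℚ.+ ((a ⋆ f i) k ℚ.- (a k ℚ.+ f i k))
        ≡⟨ cong₂ ℚ._+_ (foldl-⋆-excess-agree f g is k f≈g (⋆-agree a≈a' fi≈gi))
                       (⋆-excess-agree k a≈a' fi≈gi) ⟩
      (fold a' g ℚ.- ((a' ⋆ g i) k ℚ.+ Σ g)) ℚ.+ ((a' ⋆ g i) k ℚ.- (a' k ℚ.+ g i k))
        ≡⟨ regroup (fold a' g) ((a' ⋆ g i) k) (a' k) (g i k) (Σ g) ⟨
      fold a' g ℚ.- (a' k ℚ.+ (g i k ℚ.+ Σ g)) ∎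
      where
      fold : Vec d → (I → Vec d) → ℚ
      fold b h = foldl _⋆_ (b ⋆ h i) (map h is) k

      Σ : (I → Vec d) → ℚ
      Σ h = sumV (map h is) k

      regroup : ∀ F M A V S → F ℚ.- (A ℚ.+ (V ℚ.+ S)) ≡ (F ℚ.- (M ℚ.+ S)) ℚ.+ (M ℚ.- (A ℚ.+ V))
      regroup = solve 5 (λ F M A V S → F :- (A :+ (V :+ S)) := (F :- (M :+ S)) :+ (M :- (A :+ V))) refl

    secondKind-excess-agree : ∀ {t t'} k → AgreeBelow (toℕ k) t t' →
      secondKind (suc s-1) c t k ℚ.- fromℤ (t k) ≡ secondKind (suc s-1) c t' k ℚ.- fromℤ (t' k)
    secondKind-excess-agree {t} {t'} k t≈t' = begin
      secondKind (suc s-1) c t k ℚ.- fromℤ (t k)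
        ≡⟨ cong (secondKind (suc s-1) c t k ℚ.+_) (cong ℚ.-_ (sum≡ t)) ⟩
      secondKind (suc s-1) c t k ℚ.- (0ℚ ℚ.+ sumV (map (scaledBasis t) (allFin d)) k)
        ≡⟨ foldl-⋆-excess-agree (scaledBasis t) (scaledBasis t') (allFin d) k
             (All.universal (scaledBasis-agree t≈t') (allFin d)) (λ _ _ → refl) ⟩
      secondKind (suc s-1) c t' k ℚ.- (0ℚ ℚ.+ sumV (map (scaledBasis t') (allFin d)) k)
        ≡⟨ cong (secondKind (suc s-1) c t' k ℚ.+_) (cong ℚ.-_ (sum≡ t')) ⟨
      secondKind (suc s-1) c t' k ℚ.- fromℤ (t' k) ∎
      where
      sum≡ : ∀ u → fromℤ (u k) ≡ 0ℚ ℚ.+ sumV (map (scaledBasis u) (allFin d)) k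
      sum≡ u = sym (trans (ℚP.+-identityˡ _) (sumV-scaledBasis u k))

-- Triangular maps

module _ {A : Set} {d : ℕ} (F : (Fin d → A) → Fin d → A)
  (F-triangular : ∀ {t t'} k → AgreeBelow (toℕ k) t t' → F t k ≡ F t' k) where

  private
    iterate : ℕ → (Fin d → A) → Fin d → A
    iterate zero    t = t
    iterate (suc n) t = F (iterate n t)

    iterate-agree : ∀ n t → AgreeBelow n (iterate n t) (iterate (suc n) t)
    iterate-agree zero    t j ()
    iterate-agree (suc n) t j j<1+n =
      F-triangular j λ i i<j → iterate-agree n t i (ℕP.<-≤-trans i<j (ℕP.≤-pred j<1+n))

  triangular-fixedPoint : (Fin d → A) → ∃ λ t → ∀ k → F t k ≡ t k
  triangular-fixedPoint t₀ = iterate d t₀ , λ k → sym (iterate-agree d t₀ k (FinP.toℕ<n k))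

module Coordinates (s-1 : ℕ) {d} (c : Struct d) (C : ℕ) (c-multiple : AllDivisibleBy C c)
  (den∣C : All (λ σ → den σ ∣ C) (higherSeqs s-1))
  (c-vanishes₁ : ∀ i j k → toℕ k ≤ toℕ i → c i j k ≡ 0ℚ)
  (c-vanishes₂ : ∀ i j k → toℕ k ≤ toℕ j → c i j k ≡ 0ℚ) where

  open BCH s-1 c
  open Integral C c-multiple den∣C
  open Triangular c-vanishes₁ c-vanishes₂

  coords : (Fin d → ℤ) → Fin d → ℤ
  coords t k = proj₁ (secondKind-int t k)

  secondKind≈coords : ∀ t → secondKind (suc s-1) c t ≈V embedℤ (coords t)
  secondKind≈coords t k = proj₂ (secondKind-int t k)

  coords-excess-agree : ∀ {t t'} k → AgreeBelow (toℕ k) t t' → coords t k ℤ.- t k ≡ coords t' k ℤ.- t' k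
  coords-excess-agree {t} {t'} k t≈t' = fromℤ-injective (begin
    fromℤ (coords t k ℤ.- t k)                    ≡⟨ excess≡ t ⟨
    secondKind (suc s-1) c t k ℚ.- fromℤ (t k)    ≡⟨ secondKind-excess-agree k t≈t' ⟩
    secondKind (suc s-1) c t' k ℚ.- fromℤ (t' k)  ≡⟨ excess≡ t' ⟩
    fromℤ (coords t' k ℤ.- t' k)                  ∎)
    where
    excess≡ : ∀ u → secondKind (suc s-1) c u k ℚ.- fromℤ (u k) ≡ fromℤ (coords u k ℤ.- u k)
    excess≡ u = trans (cong (ℚ._- fromℤ (u k)) (secondKind≈coords u k)) (fromℤ-minus (coords u k) (u k))

  -- A fixed point of t ↦ z - (coords t - t) solves coords t = z.
  coords-surjective : ∀ z → ∃ λ t → ∀ k → coords t k ≡ z k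
  coords-surjective z =
    let (t , fixed) = triangular-fixedPoint F F-triangular z
    in  t , λ k → a-[b-c]≡c⇒b≡a (fixed k)
    where
    F : (Fin d → ℤ) → Fin d → ℤ
    F t k = z k ℤ.- (coords t k ℤ.- t k)

    F-triangular : ∀ {t t'} k → AgreeBelow (toℕ k) t t' → F t k ≡ F t' k
    F-triangular k t≈t' = cong (λ e → z k ℤ.- e) (coords-excess-agree k t≈t')

  psiExpΓ : PsiExpΓIsℤ^d (suc s-1) c
  psiExpΓ = (λ t → coords t , secondKind≈coords t)
          , λ z → let (t , coords≡z) = coords-surjective z in
                  t , λ k → trans (cong fromℤ (sym (coords≡z k))) (sym (secondKind≈coords t k))

lemma2p5 : ∀ (s : ℕ) → 1 ≤ s → ∃ λ (C : ℕ) → 1 ≤ C ×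
    (∀ (d : ℕ) (c : Struct d) (D : ℕ → ℕ) → IsFilteredNilmanifold s d c D →
      AllDivisibleBy C c → PsiExpΓIsℤ^d s c)
lemma2p5 zero      ()
lemma2p5 (suc s-1) _ = dynkinConstant s-1 , dynkinConstant-positive s-1 ,
  λ d c D filtered c-multiple →
    Coordinates.psiExpΓ s-1 c (dynkinConstant s-1) c-multiple (den∣dynkinConstant s-1)
      (IsFilteredNilmanifold.triangular filtered) (IsFilteredNilmanifold.triangular' filtered)
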